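{- Let $p<q<r$ be primes and let $N>1$ be an integer whose divisors $1=d_1<d_2<\cdots$ satisfy $d_2=p$, $d_3=q$, $d_4=p^2$, $d_5=r$, all lying in $S'_N$, and suppose $N$ is small recurrent with $U(p,q,a,b)$ for some integers $a,b$. Then $|S_N|\le 7$; as a result $|S'_N|\le 6$.
   Context: For an integer $N>1$ let $1=d_1<d_2<\cdots<d_{\tau(N)}=N$ be its divisors, $S_N=\{d:1\le d\le\sqrt N,\ d\mid N\}$ and $S'_N=\{d:1<d<\sqrt N,\ d\mid N\}=\{d_2,d_3,\ldots\}$. "$N$ is small recurrent with $U(p,q,a,b)$" means $d_2=p$, $d_3=q$, and $d_i=ad_{i-1}+bd_{i-2}$ for every $i\ge4$ with $d_i\in S'_N$. -}

module Defs where

open import Data.Nat using (ℕ; zero; suc; _*_; _<_; _≤_; _≤?_; _<?_; _∸_)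
open import Data.Nat.Divisibility using (_∣_; _∣?_)
open import Data.Integer as ℤ using (ℤ; +_)
open import Data.List using (List; []; _∷_; filter; map; upTo; length)
open import Data.Product using (_×_)
open import Relation.Binary.PropositionalEquality using (_≡_)

divisorsOf : ℕ → List ℕ
divisorsOf N = filter (λ d → d ∣? N) (map suc (upTo N))

nth : List ℕ → ℕ → ℕ
nth []       _       = 0
nth (x ∷ xs) zero    = x
nth (x ∷ xs) (suc i) = nth xs i

-- d N i = d_i, the i-th smallest divisor of N (1-based; 0 if out of range).
d : ℕ → ℕ → ℕ
d N i = nth (divisorsOf N) (i ∸ 1)

-- S_N = {d : 1 ≤ d ≤ √N, d ∣ N}  (d ≤ √N ⇔ d*d ≤ N)
S : ℕ → List ℕ
S N = filter (λ x → x * x ≤? N) (divisorsOf N)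

-- S'_N = {d : 1 < d < √N, d ∣ N}  (d < √N ⇔ d*d < N)
S' : ℕ → List ℕ
S' N = filter (λ x → 1 <? x) (filter (λ x → x * x <? N) (divisorsOf N))

InS' : ℕ → ℕ → Set
InS' N x = x ∣ N × 1 < x × x * x < N

SmallRecurrent : ℕ → ℕ → ℕ → ℤ → ℤ → Set
SmallRecurrent N p q a b =
  d N 2 ≡ p × d N 3 ≡ q ×
  (∀ i → 4 ≤ i → InS' N (d N i) →
     + d N i ≡ a ℤ.* + d N (i ∸ 1) ℤ.+ b ℤ.* + d N (i ∸ 2))

-- Writing the recurrence at d₄ = p² gives p ∣ a, so a = A p, b = p − A q and
-- d_i = A p d_{i−1} + (p − A q) d_{i−2}. Suppose d₈ ≤ √N, so that d₄, …, d₈ all obey it.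
-- Then d₆ = p m₆ for a divisor m₆ of N; as no divisor lies strictly between p and q and
-- d₆ ≤ pq, m₆ = q, and the resulting relation A (pq − r) = p² − q forces A ≥ 1. Hence
-- d₇ < pr and d₈ ≤ pr. If d₈² = N then qr ∣ d₈ ≤ pr, which is absurd. Otherwise
-- d₈ = p m₈ for a divisor q < m₈ ≤ r, i.e. m₈ ∈ {p², r}. If m₈ = r, then d₇ = p³ and
-- (p − A q)(r − p²) = 0. If m₈ = p², then q ∣ p²(p + 1), so (p, q, r) = (2, 3, 5), A = 1 and
-- d_i = i for i ≤ 8; the recurrence d_i = 2 d_{i−1} − d_{i−2} then yields d_i = i for every i,
-- because the next divisor after m is at most 2o for the odd o ∈ {m − 1, m}, and
-- (2o)² < (o − 2)(o − 1) o ≤ N keeps it below √N. So d₈ > √N.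

module Submission where

open import Data.Empty using (⊥; ⊥-elim)
open import Data.Integer as ℤ using (ℤ; +_; -[1+_]; 0ℤ; 1ℤ; -1ℤ)
import Data.Integer.Divisibility.Signed as ℤ∣
import Data.Integer.Properties as ℤP
import Data.Integer.Tactic.RingSolver as ℤ-Solver
open import Data.List using (List; []; _∷_; filter; map; upTo; length)
open import Data.List.Membership.Propositional using (_∈_)
import Data.List.Membership.Propositional.Properties as ∈
open import Data.List.Properties using (length-filter)
open import Data.List.Relation.Unary.All as All using (All)
open import Data.List.Relation.Unary.AllPairs as AllPairs using (AllPairs)
import Data.List.Relation.Unary.AllPairs.Properties as AllPairsₚ
open import Data.List.Relation.Unary.Any using (here; there)
open import Data.Nat
open import Data.Nat.Coprimality as Coprime
  using (Coprime; coprime⇒gcd≡1; coprime-divisor; coprime-+; 1-coprimeTo; prime⇒coprime)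
open import Data.Nat.Divisibility
open import Data.Nat.LCM using (lcm; lcm-least; gcd*lcm)
open import Data.Nat.Primality
  using (Prime; prime[2]; prime⇒irreducible; prime⇒nonTrivial; prime⇒nonZero; euclidsLemma)
open import Data.Nat.Properties
import Data.Nat.Tactic.RingSolver as ℕ-Solver
open import Data.Product using (∃; _×_; _,_; proj₁; proj₂)
open import Data.Sum using (_⊎_; inj₁; inj₂; [_,_]′)
open import Function using (id)
open import Relation.Nullary using (¬_; yes; no)
open import Relation.Unary using (Pred; Decidable)
open import Relation.Binary.PropositionalEquality

open import Defs

nth-∈ : ∀ (xs : List ℕ) {i} → i < length xs → nth xs i ∈ xs
nth-∈ (x ∷ xs) {zero}  _       = here refl
nth-∈ (x ∷ xs) {suc i} (s≤s i<n) = there (nth-∈ xs i<n)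

∈⇒nth : ∀ {x} {xs : List ℕ} → x ∈ xs → ∃ λ i → i < length xs × nth xs i ≡ x
∈⇒nth (here refl) = 0 , s≤s z≤n , refl
∈⇒nth (there x∈xs) with ∈⇒nth x∈xs
... | i , i<n , eq = suc i , s≤s i<n , eq

nth-≥length : ∀ (xs : List ℕ) {i} → length xs ≤ i → nth xs i ≡ 0
nth-≥length []       _         = refl
nth-≥length (x ∷ xs) (s≤s n≤i) = nth-≥length xs n≤i

All-nth : ∀ {ℓ} {P : Pred ℕ ℓ} {xs} → All P xs → ∀ {i} → i < length xs → P (nth xs i)
All-nth (px All.∷ _)  {zero}  _         = px
All-nth (_ All.∷ pxs) {suc i} (s≤s i<n) = All-nth pxs i<n

AllPairs-nth : ∀ {xs} → AllPairs _<_ xs → ∀ {i j} → i < j → j < length xs → nth xs i < nth xs j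
AllPairs-nth (x<xs AllPairs.∷ _)   {zero}  {suc j} _         (s≤s j<n) = All-nth x<xs j<n
AllPairs-nth (_ AllPairs.∷ sorted) {suc i} {suc j} (s≤s i<j) (s≤s j<n) = AllPairs-nth sorted i<j j<n

length-filter-≤ : ∀ {ℓ} {P : Pred ℕ ℓ} (P? : Decidable P) (xs : List ℕ) k →
  (∀ {j} → k ≤ j → j < length xs → ¬ P (nth xs j)) → length (filter P? xs) ≤ k
length-filter-≤ P? []       k       _ = z≤n
length-filter-≤ P? (x ∷ xs) k       fails with P? x
length-filter-≤ P? (x ∷ xs) zero    fails | yes px = ⊥-elim (fails z≤n (s≤s z≤n) px)
length-filter-≤ P? (x ∷ xs) (suc k) fails | yes _  =
  s≤s (length-filter-≤ P? xs k (λ k≤j j<n → fails (s≤s k≤j) (s≤s j<n)))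
length-filter-≤ P? (x ∷ xs) k       fails | no _   =
  length-filter-≤ P? xs k (λ k≤j j<n → fails (m≤n⇒m≤1+n k≤j) (s≤s j<n))

length-filter-filter-∷ : ∀ {ℓ ℓ′} {P : Pred ℕ ℓ} {Q : Pred ℕ ℓ′} (P? : Decidable P) (Q? : Decidable Q)
  {x} xs → ¬ P x → length (filter P? (filter Q? (x ∷ xs))) ≤ length (filter Q? xs)
length-filter-filter-∷ P? Q? {x} xs ¬px with Q? x
... | no _  = length-filter P? (filter Q? xs)
... | yes _ with P? x
...   | yes px = ⊥-elim (¬px px)
...   | no _   = length-filter P? (filter Q? xs)

divisorsOf-sorted : ∀ N → AllPairs _<_ (divisorsOf N)
divisorsOf-sorted N = AllPairsₚ.filter⁺ (_∣? N)
  (AllPairsₚ.map⁺ (AllPairsₚ.applyUpTo⁺₁ id N (λ i<j _ → s≤s i<j)))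

∈-divisorsOf⁻ : ∀ {N x} → x ∈ divisorsOf N → x ∣ N × 0 < x
∈-divisorsOf⁻ {N} x∈ with ∈.∈-filter⁻ (_∣? N) {xs = map suc (upTo N)} x∈
... | x∈′ , x∣N with ∈.∈-map⁻ suc x∈′
...   | _ , _ , refl = x∣N , s≤s z≤n

∈-divisorsOf⁺ : ∀ {N x} → 0 < N → x ∣ N → 0 < x → x ∈ divisorsOf N
∈-divisorsOf⁺ {suc N} {suc x} _ x∣N _ =
  ∈.∈-filter⁺ (_∣? suc N) (∈.∈-map⁺ suc (∈.∈-upTo⁺ (∣⇒≤ x∣N))) x∣N

-- Positions are written suc i: d N (suc i) unfolds to nth (divisorsOf N) i, while d N 0 is a
-- junk copy of d N 1; nth returns 0 past the end, so 0 < d N (suc i) says that d_{i+1} exists.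
module _ {N : ℕ} where

  d-pos : ∀ {i} → i < length (divisorsOf N) → 0 < d N (suc i)
  d-pos i<n = proj₂ (∈-divisorsOf⁻ {N} (nth-∈ (divisorsOf N) i<n))

  d-defined : ∀ {i} → 0 < d N (suc i) → i < length (divisorsOf N)
  d-defined {i} pos with i <? length (divisorsOf N)
  ... | yes i<n = i<n
  ... | no i≮n rewrite nth-≥length (divisorsOf N) (≮⇒≥ i≮n) = ⊥-elim (<-irrefl refl pos)

  d-∣ : ∀ {i} → 0 < d N (suc i) → d N (suc i) ∣ N
  d-∣ pos = proj₁ (∈-divisorsOf⁻ {N} (nth-∈ (divisorsOf N) (d-defined pos)))

  d-<-mono : ∀ {i j} → i < j → 0 < d N (suc j) → d N (suc i) < d N (suc j)
  d-<-mono i<j pos = AllPairs-nth (divisorsOf-sorted N) i<j (d-defined pos)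

  d-≤-mono : ∀ {i j} → i ≤ j → 0 < d N (suc j) → d N (suc i) ≤ d N (suc j)
  d-≤-mono i≤j pos with m≤n⇒m<n∨m≡n i≤j
  ... | inj₁ i<j  = <⇒≤ (d-<-mono i<j pos)
  ... | inj₂ refl = ≤-refl

  d-pos-mono : ∀ {i j} → i ≤ j → 0 < d N (suc j) → 0 < d N (suc i)
  d-pos-mono i≤j pos = d-pos (≤-<-trans i≤j (d-defined pos))

  d-least : ∀ {i x} → 0 < N → x ∣ N → 0 < x → 0 < d N (suc i) → d N (suc i) < x →
            0 < d N (suc (suc i)) × d N (suc (suc i)) ≤ x
  d-least {i} N>0 x∣N x>0 pos d<x with ∈⇒nth (∈-divisorsOf⁺ N>0 x∣N x>0)
  ... | j , j<n , refl with suc i ≤? j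
  ... | yes i<j = d-pos-mono i<j (d-pos j<n) , d-≤-mono i<j (d-pos j<n)
  ... | no  i≮j = ⊥-elim (<⇒≱ d<x (d-≤-mono (≮⇒≥ i≮j) pos))

  d-1≡1 : 0 < N → d N 1 ≡ 1
  d-1≡1 N>0 with ∈⇒nth (∈-divisorsOf⁺ N>0 (1∣ N) (s≤s z≤n))
  ... | j , j<n , eq =
    ≤-antisym (subst (d N 1 ≤_) eq (d-≤-mono z≤n (subst (0 <_) (sym eq) (s≤s z≤n))))
              (d-pos (≤-<-trans z≤n j<n))

  divisorsOf-≡1∷ : 0 < N → ∃ λ ys → divisorsOf N ≡ 1 ∷ ys
  divisorsOf-≡1∷ N>0 with divisorsOf N | d-1≡1 N>0
  ... | x ∷ ys | refl = ys , refl

  InS'-below : ∀ {i j} → 0 < N → 2 ≤ i → i < j → 0 < d N j → d N j * d N j ≤ N → InS' N (d N i)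
  InS'-below {suc (suc i)} {suc j} N>0 (s≤s (s≤s z≤n)) (s≤s i<j) pos d²≤N =
    d-∣ (d-pos-mono (<⇒≤ i<j) pos) ,
    subst (_< d N (suc (suc i))) (d-1≡1 N>0) (d-<-mono (s≤s z≤n) (d-pos-mono (<⇒≤ i<j) pos)) ,
    <-≤-trans (*-mono-< (d-<-mono i<j pos) (d-<-mono i<j pos)) d²≤N

  length-S-≤ : ∀ k → (0 < d N (suc k) → N < d N (suc k) * d N (suc k)) → length (S N) ≤ k
  length-S-≤ k large = length-filter-≤ (λ x → x * x ≤? N) (divisorsOf N) k λ k≤j j<n →
    let pos = d-pos j<n
        dk≤dj = d-≤-mono k≤j pos
    in <⇒≱ (<-≤-trans (large (d-pos-mono k≤j pos)) (*-mono-≤ dk≤dj dk≤dj))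

  length-S'-≤ : ∀ k → 0 < N →
    (0 < d N (suc (suc k)) → N < d N (suc (suc k)) * d N (suc (suc k))) → length (S' N) ≤ k
  length-S'-≤ k N>0 large with divisorsOf-≡1∷ N>0
  ... | ys , eq = subst (λ xs → length (filter (λ x → 1 <? x) (filter (λ x → x * x <? N) xs)) ≤ k) (sym eq)
    (≤-trans (length-filter-filter-∷ (λ x → 1 <? x) (λ x → x * x <? N) ys (<-irrefl refl))
             (length-filter-≤ (λ x → x * x <? N) ys k λ {j} k≤j j<n →
               let d≡ : nth ys j ≡ d N (suc (suc j))
                   d≡ = cong (λ xs → nth xs (suc j)) (sym eq)
                   pos = d-pos (subst (λ xs → suc j < length xs) (sym eq) (s≤s j<n))
                   dk≤dj = d-≤-mono (s≤s k≤j) pos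
               in subst (λ x → ¬ x * x < N) (sym d≡)
                    (<⇒≯ (<-≤-trans (large (d-pos-mono (s≤s k≤j) pos)) (*-mono-≤ dk≤dj dk≤dj)))))

coprime⇒*∣ : ∀ {m n o} → Coprime m n → m ∣ o → n ∣ o → m * n ∣ o
coprime⇒*∣ {m} {n} c m∣o n∣o = subst (_∣ _) lcm≡m*n (lcm-least m∣o n∣o)
  where
  lcm≡m*n : lcm m n ≡ m * n
  lcm≡m*n = trans (sym (*-identityˡ (lcm m n)))
                  (trans (cong (_* lcm m n) (sym (coprime⇒gcd≡1 c))) (gcd*lcm m n))

coprime-*ˡ : ∀ {m n o} → Coprime m o → Coprime n o → Coprime (m * n) o
coprime-*ˡ m⊥o n⊥o (i∣mn , i∣o) =
  n⊥o (coprime-divisor (λ (j∣i , j∣m) → m⊥o (j∣m , ∣-trans j∣i i∣o)) i∣mn , i∣o)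

coprime-suc : ∀ n → Coprime n (suc n)
coprime-suc n = Coprime.sym (subst (λ x → Coprime x n) (+-comm n 1) (coprime-+ (1-coprimeTo n)))

prime>1 : ∀ {p} → Prime p → 1 < p
prime>1 {p} p-prime = nonTrivial⇒n>1 p {{prime⇒nonTrivial p-prime}}

primes-coprime : ∀ {p q} → Prime p → Prime q → p < q → Coprime p q
primes-coprime p-prime q-prime p<q = Coprime.sym (prime⇒coprime q-prime {{prime⇒nonZero p-prime}} p<q)

prime∣m*m⇒∣m : ∀ {p m} → Prime p → p ∣ m * m → p ∣ m
prime∣m*m⇒∣m {m = m} p-prime p∣m² with euclidsLemma m m p-prime p∣m²
... | inj₁ p∣m = p∣m
... | inj₂ p∣m = p∣m

2∣n⊎2∣1+n : ∀ n → 2 ∣ n ⊎ 2 ∣ suc n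
2∣n⊎2∣1+n zero    = inj₁ (2 ∣0)
2∣n⊎2∣1+n (suc n) with 2∣n⊎2∣1+n n
... | inj₁ 2∣n   = inj₂ (∣m∣n⇒∣m+n ∣-refl 2∣n)
... | inj₂ 2∣1+n = inj₁ 2∣1+n

2∣n⇒¬2∣1+n : ∀ {n} → 2 ∣ n → ¬ 2 ∣ suc n
2∣n⇒¬2∣1+n {n} 2∣n 2∣1+n with ∣1⇒≡1 (∣m+n∣m⇒∣n (subst (2 ∣_) (+-comm 1 n) 2∣1+n) 2∣n)
... | ()

odd⇒coprime-2 : ∀ {n} → ¬ 2 ∣ n → Coprime 2 n
odd⇒coprime-2 odd (i∣2 , i∣n) with prime⇒irreducible prime[2] i∣2
... | inj₁ i≡1 = i≡1
... | inj₂ refl = ⊥-elim (odd i∣n)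

odd⇒coprime-+2 : ∀ {n} → ¬ 2 ∣ n → Coprime n (2 + n)
odd⇒coprime-+2 {n} odd = Coprime.sym (subst (λ x → Coprime x n) (+-comm n 2) (coprime-+ (odd⇒coprime-2 odd)))

odd-between : ∀ n → ∃ λ o → ¬ 2 ∣ o × n ≤ o × o ≤ suc n
odd-between n with 2∣n⊎2∣1+n n
... | inj₁ 2∣n   = suc n , 2∣n⇒¬2∣1+n 2∣n , n≤1+n n , ≤-refl
... | inj₂ 2∣1+n = n , (λ 2∣n → 2∣n⇒¬2∣1+n 2∣n 2∣1+n) , ≤-refl , n≤1+n n

consecutive-primes : ∀ {p} → Prime p → Prime (suc p) → p ≡ 2
consecutive-primes {p} p-prime p+1-prime with 2∣n⊎2∣1+n p
... | inj₁ 2∣p with prime⇒irreducible p-prime 2∣p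
...   | inj₁ ()
...   | inj₂ 2≡p = sym 2≡p
consecutive-primes {p} p-prime p+1-prime | inj₂ 2∣1+p with prime⇒irreducible p+1-prime 2∣1+p
...   | inj₁ ()
...   | inj₂ refl = ⊥-elim (<-irrefl refl (prime>1 p-prime))

prime-divisor-≡ : ∀ {m n} → Prime n → 1 < m → m ∣ n → m ≡ n
prime-divisor-≡ n-prime 1<m m∣n with prime⇒irreducible n-prime m∣n
... | inj₁ refl = ⊥-elim (<-irrefl refl 1<m)
... | inj₂ m≡n  = m≡n

combination₁ : ∀ {x y e f : ℤ} → e ≡ f → ∀ c → x ℤ.- y ≡ c ℤ.* (e ℤ.- f) → x ≡ y
combination₁ {x} {y} {e} {f} e≡f c x-y≡ = ℤP.i-j≡0⇒i≡j x y (begin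
  x ℤ.- y            ≡⟨ x-y≡ ⟩
  c ℤ.* (e ℤ.- f)    ≡⟨ cong (c ℤ.*_) (ℤP.i≡j⇒i-j≡0 e≡f) ⟩
  c ℤ.* 0ℤ           ≡⟨ ℤP.*-zeroʳ c ⟩
  0ℤ                 ∎)
  where open ≡-Reasoning

combination₂ : ∀ {x y e f e′ f′ : ℤ} → e ≡ f → e′ ≡ f′ → ∀ c c′ →
  x ℤ.- y ≡ c ℤ.* (e ℤ.- f) ℤ.+ c′ ℤ.* (e′ ℤ.- f′) → x ≡ y
combination₂ {x} {y} {e} {f} {e′} {f′} e≡f e′≡f′ c c′ x-y≡ = ℤP.i-j≡0⇒i≡j x y (begin
  x ℤ.- y                                  ≡⟨ x-y≡ ⟩
  c ℤ.* (e ℤ.- f) ℤ.+ c′ ℤ.* (e′ ℤ.- f′)   ≡⟨ cong₂ (λ u v → c ℤ.* u ℤ.+ c′ ℤ.* v) (ℤP.i≡j⇒i-j≡0 e≡f) (ℤP.i≡j⇒i-j≡0 e′≡f′) ⟩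
  c ℤ.* 0ℤ ℤ.+ c′ ℤ.* 0ℤ                   ≡⟨ cong₂ ℤ._+_ (ℤP.*-zeroʳ c) (ℤP.*-zeroʳ c′) ⟩
  0ℤ                                       ∎)
  where open ≡-Reasoning

pos-∸ : ∀ {m n} → n ≤ m → + (m ∸ n) ≡ + m ℤ.- + n
pos-∸ {m} {n} n≤m = sym (trans (ℤP.m-n≡m⊖n m n) (ℤP.⊖-≥ n≤m))

∣-from-≡ : ∀ {i : ℤ} {k} j → i ≡ + k ℤ.* j → k ∣ ℤ.∣ i ∣
∣-from-≡ {k = k} j i≡kj = divides ℤ.∣ j ∣ (trans (cong ℤ.∣_∣ i≡kj) (trans (ℤP.abs-* (+ k) j) (*-comm k ℤ.∣ j ∣)))

factor-pos : ∀ {x p} .{{_ : NonZero p}} (M : ℤ) → + x ≡ + p ℤ.* M → x ≡ p * ℤ.∣ M ∣ × + ℤ.∣ M ∣ ≡ M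
factor-pos {x} {p} M x≡pM = x≡p∣M∣ , ℤP.*-cancelˡ-≡ (+ p) (+ ℤ.∣ M ∣) M
  (trans (sym (ℤP.pos-* p ℤ.∣ M ∣)) (trans (cong +_ (sym x≡p∣M∣)) x≡pM))
  where
  x≡p∣M∣ : x ≡ p * ℤ.∣ M ∣
  x≡p∣M∣ = trans (cong ℤ.∣_∣ x≡pM) (ℤP.abs-* (+ p) M)

positive-factor : ∀ (A : ℤ) {x y} → 0 < x → 0 < y → A ℤ.* + x ≡ + y → ∃ λ α → A ≡ + suc α
positive-factor (+ suc α) _ _ _ = α , refl
positive-factor (+ zero)  {suc x} {suc y} _ _ ()
positive-factor -[1+ k ]  {suc x} {suc y} _ _ ()

p²≡aq+bp⇒aq≡p[p-b] : ∀ P Q a b → P ℤ.* P ≡ a ℤ.* Q ℤ.+ b ℤ.* P → a ℤ.* Q ≡ P ℤ.* (P ℤ.- b)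
p²≡aq+bp⇒aq≡p[p-b] P Q a b h = combination₁ h (ℤ.- 1ℤ) (ℤ-Solver.solve (P ∷ Q ∷ a ∷ b ∷ []))

p²≡Apq+bp⇒bp≡[p-Aq]p : ∀ P Q A b → P ℤ.* P ≡ A ℤ.* P ℤ.* Q ℤ.+ b ℤ.* P → b ℤ.* P ≡ (P ℤ.- A ℤ.* Q) ℤ.* P
p²≡Apq+bp⇒bp≡[p-Aq]p P Q A b h = combination₁ h (ℤ.- 1ℤ) (ℤ-Solver.solve (P ∷ Q ∷ A ∷ b ∷ []))

coefficients-of-p² : ∀ {p q} (a b : ℤ) → Prime p → ¬ p ∣ q → + p ℤ.* + p ≡ a ℤ.* + q ℤ.+ b ℤ.* + p →
  ∃ λ A → a ≡ A ℤ.* + p × b ≡ + p ℤ.- A ℤ.* + q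
coefficients-of-p² {p} {q} a b p-prime p∤q p²≡ = A , a≡Ap , b≡p-Aq
  where
  P Q : ℤ
  P = + p
  Q = + q
  instance
    p≢0 : NonZero p
    p≢0 = prime⇒nonZero p-prime
  p∣a : p ∣ ℤ.∣ a ∣
  p∣a with euclidsLemma ℤ.∣ a ∣ q p-prime
             (subst (p ∣_) (ℤP.abs-* a Q) (∣-from-≡ (P ℤ.- b) (p²≡aq+bp⇒aq≡p[p-b] P Q a b p²≡)))
  ... | inj₁ p∣a = p∣a
  ... | inj₂ p∣q = ⊥-elim (p∤q p∣q)
  A : ℤ
  A = ℤ∣._∣_.quotient (ℤ∣.∣ᵤ⇒∣ {P} {a} p∣a)
  a≡Ap : a ≡ A ℤ.* P
  a≡Ap = ℤ∣._∣_.equality (ℤ∣.∣ᵤ⇒∣ {P} {a} p∣a)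
  b≡p-Aq : b ≡ P ℤ.- A ℤ.* Q
  b≡p-Aq = ℤP.*-cancelʳ-≡ b (P ℤ.- A ℤ.* Q) P
    (p²≡Apq+bp⇒bp≡[p-Aq]p P Q A b (trans p²≡ (cong (λ x → x ℤ.* Q ℤ.+ b ℤ.* P) a≡Ap)))

d₆-factor : ∀ P Q R A →
  A ℤ.* P ℤ.* R ℤ.+ (P ℤ.- A ℤ.* Q) ℤ.* (P ℤ.* P) ≡ P ℤ.* (A ℤ.* R ℤ.+ P ℤ.* P ℤ.- A ℤ.* P ℤ.* Q)
d₆-factor = ℤ-Solver.solve-∀

A*[pq-r]≡p²-q : ∀ P Q R A → Q ≡ A ℤ.* R ℤ.+ P ℤ.* P ℤ.- A ℤ.* P ℤ.* Q → A ℤ.* (P ℤ.* Q ℤ.- R) ≡ P ℤ.* P ℤ.- Q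
A*[pq-r]≡p²-q P Q R A h = combination₁ h 1ℤ (ℤ-Solver.solve (P ∷ Q ∷ R ∷ A ∷ []))

pr≡d₇+Aq[r-p²] : ∀ P Q R A →
  P ℤ.* R ≡ A ℤ.* P ℤ.* (P ℤ.* Q) ℤ.+ (P ℤ.- A ℤ.* Q) ℤ.* R ℤ.+ A ℤ.* Q ℤ.* (R ℤ.- P ℤ.* P)
pr≡d₇+Aq[r-p²] = ℤ-Solver.solve-∀

d₈-factor : ∀ P Q A D →
  A ℤ.* P ℤ.* D ℤ.+ (P ℤ.- A ℤ.* Q) ℤ.* (P ℤ.* Q) ≡ P ℤ.* (A ℤ.* D ℤ.+ P ℤ.* Q ℤ.- A ℤ.* Q ℤ.* Q)
d₈-factor = ℤ-Solver.solve-∀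

r-cofactor⇒Ad₇≡Ap³ : ∀ P Q R A D → R ≡ A ℤ.* D ℤ.+ P ℤ.* Q ℤ.- A ℤ.* Q ℤ.* Q →
  R ≡ A ℤ.* P ℤ.* (P ℤ.* P) ℤ.+ (P ℤ.- A ℤ.* Q) ℤ.* Q → A ℤ.* D ≡ A ℤ.* (P ℤ.* P ℤ.* P)
r-cofactor⇒Ad₇≡Ap³ P Q R A D h h′ = combination₂ h h′ (ℤ.- 1ℤ) 1ℤ (ℤ-Solver.solve (P ∷ Q ∷ R ∷ A ∷ D ∷ []))

d₇≡p³⇒[p-Aq][r-p²]≡0 : ∀ P Q R A → P ℤ.* P ℤ.* P ≡ A ℤ.* P ℤ.* (P ℤ.* Q) ℤ.+ (P ℤ.- A ℤ.* Q) ℤ.* R →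
  (P ℤ.- A ℤ.* Q) ℤ.* (R ℤ.- P ℤ.* P) ≡ 0ℤ
d₇≡p³⇒[p-Aq][r-p²]≡0 P Q R A h = combination₁ h (ℤ.- 1ℤ) (ℤ-Solver.solve (P ∷ Q ∷ R ∷ A ∷ []))

p²-cofactor⇒p²[p+1]≡q*X : ∀ P Q R A D → P ℤ.* P ≡ A ℤ.* D ℤ.+ P ℤ.* Q ℤ.- A ℤ.* Q ℤ.* Q →
  Q ≡ A ℤ.* R ℤ.+ P ℤ.* P ℤ.- A ℤ.* P ℤ.* Q → D ≡ A ℤ.* P ℤ.* (P ℤ.* Q) ℤ.+ (P ℤ.- A ℤ.* Q) ℤ.* R →
  P ℤ.* P ℤ.* (P ℤ.+ 1ℤ) ≡
  Q ℤ.* (A ℤ.* A ℤ.* P ℤ.* P ℤ.+ (P ℤ.+ P) ℤ.+ (A ℤ.+ A) ℤ.* P ℤ.* P ℤ.- (A ℤ.+ A) ℤ.* Q ℤ.- A ℤ.* A ℤ.* P ℤ.* Q)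
p²-cofactor⇒p²[p+1]≡q*X P Q R A _ h h′ refl =
  combination₂ h h′ 1ℤ (ℤ.- (P ℤ.- A ℤ.* Q)) (ℤ-Solver.solve (P ∷ Q ∷ R ∷ A ∷ []))

Prefix : ℕ → ℕ → Set
Prefix N m = ∀ i → i < m → d N (suc i) ≡ suc i

prefix-∣ : ∀ {N m} → Prefix N m → ∀ {i} → 0 < i → i ≤ m → i ∣ N
prefix-∣ {N} pre {suc i} _ i<m = subst (_∣ N) (pre i i<m) (d-∣ {N} (subst (0 <_) (sym (pre i i<m)) (s≤s z≤n)))

square-<-odd-triple : ∀ {N o} → 0 < N → 7 ≤ o → ¬ 2 ∣ o →
  (∀ {i} → 0 < i → i ≤ o → i ∣ N) → 2 * o * (2 * o) < N
square-<-odd-triple {N} {suc (suc (suc (suc (suc (suc (suc t))))))} N>0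
                    (s≤s (s≤s (s≤s (s≤s (s≤s (s≤s (s≤s z≤n))))))) odd ∣N =
  <-≤-trans (subst (2 * o * (2 * o) <_) (sym (triple≡ t)) (m<m+n (2 * o * (2 * o)) (s≤s z≤n)))
            (∣⇒≤ {{>-nonZero N>0}} triple∣N)
  where
  o = 7 + t
  triple≡ : ∀ t → (5 + t) * (6 + t) * (7 + t) ≡ 2 * (7 + t) * (2 * (7 + t)) + (7 + t) * (2 + (7 * t + t * t))
  triple≡ = ℕ-Solver.solve-∀
  5+t⊥7+t : Coprime (5 + t) o
  5+t⊥7+t = odd⇒coprime-+2 (λ 2∣5+t → odd (∣m∣n⇒∣m+n ∣-refl 2∣5+t))
  triple∣N : (5 + t) * (6 + t) * o ∣ N
  triple∣N = coprime⇒*∣ (coprime-*ˡ 5+t⊥7+t (coprime-suc (6 + t)))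
                        (coprime⇒*∣ (coprime-suc (5 + t)) (∣N (s≤s z≤n) (m≤n+m (5 + t) 2))
                                                          (∣N (s≤s z≤n) (m≤n+m (6 + t) 1)))
                        (∣N (s≤s z≤n) ≤-refl)

+2*[1+n]-n≡2+n : ∀ n → + 2 ℤ.* + suc n ℤ.+ -1ℤ ℤ.* + n ≡ + suc (suc n)
+2*[1+n]-n≡2+n n = identity (+ n)
  where
  identity : ∀ x → + 2 ℤ.* (1ℤ ℤ.+ x) ℤ.+ -1ℤ ℤ.* x ≡ + 2 ℤ.+ x
  identity = ℤ-Solver.solve-∀

prefix-extend : ∀ {N t} → 0 < N → SmallRecurrent N 2 3 (+ 2) -1ℤ → Prefix N (8 + t) → Prefix N (9 + t)
prefix-extend {N} {t} N>0 (_ , _ , recurrence) pre with odd-between (7 + t)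
... | o , odd , 7+t≤o , o≤8+t = extended
  where
  7≤o : 7 ≤ o
  7≤o = ≤-trans (m≤m+n 7 t) 7+t≤o
  divisors : ∀ {i} → 0 < i → i ≤ o → i ∣ N
  divisors 0<i i≤o = prefix-∣ pre 0<i (≤-trans i≤o o≤8+t)
  2o∣N : 2 * o ∣ N
  2o∣N = coprime⇒*∣ (odd⇒coprime-2 odd) (divisors (s≤s z≤n) (≤-trans (s≤s (s≤s z≤n)) 7≤o))
                                        (divisors (≤-trans (s≤s z≤n) 7≤o) ≤-refl)
  8+t<2o : 8 + t < 2 * o
  8+t<2o = ≤-trans (subst (9 + t ≤_) (double t) (m≤m+n (9 + t) (5 + t))) (*-monoʳ-≤ 2 7+t≤o)
    where
    double : ∀ t → 9 + t + (5 + t) ≡ 2 * (7 + t)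
    double = ℕ-Solver.solve-∀
  d₈₊ₜ≡8+t : d N (8 + t) ≡ 8 + t
  d₈₊ₜ≡8+t = pre (7 + t) ≤-refl
  next : 0 < d N (9 + t) × d N (9 + t) ≤ 2 * o
  next = d-least N>0 2o∣N (≤-trans (s≤s z≤n) 8+t<2o)
                 (subst (0 <_) (sym d₈₊ₜ≡8+t) (s≤s z≤n)) (subst (_< 2 * o) (sym d₈₊ₜ≡8+t) 8+t<2o)
  8+t<d₉₊ₜ : 8 + t < d N (9 + t)
  8+t<d₉₊ₜ = subst (_< d N (9 + t)) d₈₊ₜ≡8+t (d-<-mono {N} (n<1+n (7 + t)) (proj₁ next))
  d₉₊ₜ∈S' : InS' N (d N (9 + t))
  d₉₊ₜ∈S' = d-∣ {N} (proj₁ next) , <-trans (s≤s (s≤s z≤n)) 8+t<d₉₊ₜ ,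
            ≤-<-trans (*-mono-≤ (proj₂ next) (proj₂ next)) (square-<-odd-triple N>0 7≤o odd divisors)
  d₉₊ₜ≡9+t : d N (9 + t) ≡ 9 + t
  d₉₊ₜ≡9+t = ℤP.+-injective (begin
    + d N (9 + t)                                          ≡⟨ recurrence (9 + t) (s≤s (s≤s (s≤s (s≤s z≤n)))) d₉₊ₜ∈S' ⟩
    + 2 ℤ.* + d N (8 + t) ℤ.+ -1ℤ ℤ.* + d N (7 + t)
      ≡⟨ cong₂ (λ x y → + 2 ℤ.* + x ℤ.+ -1ℤ ℤ.* + y) d₈₊ₜ≡8+t (pre (6 + t) (n≤1+n _)) ⟩
    + 2 ℤ.* + (8 + t) ℤ.+ -1ℤ ℤ.* + (7 + t)               ≡⟨ +2*[1+n]-n≡2+n (7 + t) ⟩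
    + (9 + t)                                              ∎)
    where open ≡-Reasoning
  extended : Prefix N (9 + t)
  extended i i<9+t with m≤n⇒m<n∨m≡n (s≤s⁻¹ i<9+t)
  ... | inj₁ i<8+t = pre i i<8+t
  ... | inj₂ refl  = d₉₊ₜ≡9+t

prefix-absurd : ∀ {N} → 0 < N → SmallRecurrent N 2 3 (+ 2) -1ℤ → Prefix N 8 → ⊥
prefix-absurd {N} N>0 recurrent pre = <⇒≱ (n<1+n N) (∣⇒≤ {{>-nonZero N>0}} (prefix-∣ (grow N) (s≤s z≤n) (m≤n+m (suc N) 7)))
  where
  grow : ∀ t → Prefix N (8 + t)
  grow zero    = pre
  grow (suc t) = prefix-extend N>0 recurrent (grow t)


module EighthDivisorAtMostRoot
  {p q r N : ℕ} {a b : ℤ}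
  (p-prime : Prime p) (q-prime : Prime q) (r-prime : Prime r) (p<q : p < q) (q<r : q < r) (N>0 : 0 < N)
  (d₂≡p : d N 2 ≡ p) (d₃≡q : d N 3 ≡ q) (d₄≡p² : d N 4 ≡ p * p) (d₅≡r : d N 5 ≡ r)
  (recurrent : SmallRecurrent N p q a b)
  (d₈>0 : 0 < d N 8) (d₈²≤N : d N 8 * d N 8 ≤ N)
  where

  private
    P Q R : ℤ
    P = + p
    Q = + q
    R = + r
    instance
      _ = prime⇒nonZero p-prime
      _ = prime⇒nonZero q-prime
      _ = prime⇒nonZero r-prime

  d>0 : ∀ {i} → i ≤ 7 → 0 < d N (suc i)
  d>0 i≤7 = d-pos-mono {N} i≤7 d₈>0

  d-increasing : ∀ {i} → i ≤ 6 → d N (suc i) < d N (2 + i)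
  d-increasing i≤6 = d-<-mono {N} ≤-refl (d>0 (s≤s i≤6))

  d∈S' : ∀ {i} → 2 ≤ i → i < 8 → InS' N (d N i)
  d∈S' 2≤i i<8 = InS'-below N>0 2≤i i<8 d₈>0 d₈²≤N

  p∣N : p ∣ N
  p∣N = subst (_∣ N) d₂≡p (d-∣ {N} (d>0 {1} (s≤s z≤n)))
  q∣N : q ∣ N
  q∣N = subst (_∣ N) d₃≡q (d-∣ {N} (d>0 {2} (s≤s (s≤s z≤n))))
  r∣N : r ∣ N
  r∣N = subst (_∣ N) d₅≡r (d-∣ {N} (d>0 {4} (s≤s (s≤s (s≤s (s≤s z≤n))))))

  p<r : p < r
  p<r = <-trans p<q q<r
  q<p² : q < p * p
  q<p² = subst₂ _<_ d₃≡q d₄≡p² (d-increasing {2} (s≤s (s≤s z≤n)))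
  p²<r : p * p < r
  p²<r = subst₂ _<_ d₄≡p² d₅≡r (d-increasing {3} (s≤s (s≤s (s≤s z≤n))))

  pq∣N : p * q ∣ N
  pq∣N = coprime⇒*∣ (primes-coprime p-prime q-prime p<q) p∣N q∣N
  pr∣N : p * r ∣ N
  pr∣N = coprime⇒*∣ (primes-coprime p-prime r-prime p<r) p∣N r∣N

  recurrence : ∀ i → 4 ≤ i → InS' N (d N i) → + d N i ≡ a ℤ.* + d N (i ∸ 1) ℤ.+ b ℤ.* + d N (i ∸ 2)
  recurrence = proj₂ (proj₂ recurrent)

  d₄-equation : P ℤ.* P ≡ a ℤ.* Q ℤ.+ b ℤ.* P
  d₄-equation = begin
    P ℤ.* P                           ≡⟨ sym (ℤP.pos-* p p) ⟩
    + (p * p)                         ≡⟨ cong +_ (sym d₄≡p²) ⟩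
    + d N 4                           ≡⟨ recurrence 4 ≤-refl (d∈S' (s≤s (s≤s z≤n)) (s≤s (s≤s (s≤s (s≤s (s≤s z≤n)))))) ⟩
    a ℤ.* + d N 3 ℤ.+ b ℤ.* + d N 2   ≡⟨ cong₂ (λ x y → a ℤ.* + x ℤ.+ b ℤ.* + y) d₃≡q d₂≡p ⟩
    a ℤ.* Q ℤ.+ b ℤ.* P               ∎
    where open ≡-Reasoning

  coefficients : ∃ λ A → a ≡ A ℤ.* P × b ≡ P ℤ.- A ℤ.* Q
  coefficients = coefficients-of-p² a b p-prime
    (λ p∣q → <-irrefl (prime-divisor-≡ q-prime (prime>1 p-prime) p∣q) p<q) d₄-equation

  A : ℤ
  A = proj₁ coefficients

  recurrence-at : ∀ {i x y} → 4 ≤ i → InS' N (d N i) → d N (i ∸ 1) ≡ x → d N (i ∸ 2) ≡ y →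
         + d N i ≡ A ℤ.* P ℤ.* + x ℤ.+ (P ℤ.- A ℤ.* Q) ℤ.* + y
  recurrence-at {i} 4≤i ∈S' refl refl = trans (recurrence i 4≤i ∈S')
    (cong₂ (λ α β → α ℤ.* + d N (i ∸ 1) ℤ.+ β ℤ.* + d N (i ∸ 2)) (proj₁ (proj₂ coefficients)) (proj₂ (proj₂ coefficients)))

  +p*p≡P*P : + (p * p) ≡ P ℤ.* P
  +p*p≡P*P = ℤP.pos-* p p
  +p*q≡P*Q : + (p * q) ≡ P ℤ.* Q
  +p*q≡P*Q = ℤP.pos-* p q

  d₅-equation : R ≡ A ℤ.* P ℤ.* (P ℤ.* P) ℤ.+ (P ℤ.- A ℤ.* Q) ℤ.* Q
  d₅-equation = trans (cong +_ (sym d₅≡r))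
    (trans (recurrence-at (s≤s (s≤s (s≤s (s≤s z≤n))))
                          (d∈S' (s≤s (s≤s z≤n)) (s≤s (s≤s (s≤s (s≤s (s≤s (s≤s z≤n))))))) d₄≡p² d₃≡q)
           (cong (λ x → A ℤ.* P ℤ.* x ℤ.+ (P ℤ.- A ℤ.* Q) ℤ.* Q) +p*p≡P*P))

  d-next≤ : ∀ {i x} → i ≤ 6 → x ∣ N → 0 < x → d N (suc i) < x → d N (2 + i) ≤ x
  d-next≤ i≤6 x∣N x>0 d<x = proj₂ (d-least {N} N>0 x∣N x>0 (d>0 (≤-trans i≤6 (n≤1+n 6))) d<x)

  pq>0 : 0 < p * q
  pq>0 = >-nonZero⁻¹ (p * q) {{m*n≢0 p q}}
  pr>0 : 0 < p * r
  pr>0 = >-nonZero⁻¹ (p * r) {{m*n≢0 p r}}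

  r<pq : r < p * q
  r<pq = ≤∧≢⇒< r≤pq r≢pq
    where
    r≤pq : r ≤ p * q
    r≤pq = subst (_≤ p * q) d₅≡r (d-next≤ (s≤s (s≤s (s≤s z≤n))) pq∣N pq>0 (subst (_< p * q) (sym d₄≡p²) (*-monoʳ-< p p<q)))
    r≢pq : r ≢ p * q
    r≢pq r≡pq = <-irrefl (prime-divisor-≡ r-prime (prime>1 p-prime) (divides q (trans r≡pq (*-comm p q)))) p<r

  record Cofactor (x : ℕ) (M : ℤ) : Set where
    field
      x≡pm : x ≡ p * ℤ.∣ M ∣
      +m≡M : + ℤ.∣ M ∣ ≡ M
      m∣N  : ℤ.∣ M ∣ ∣ N
      m>0  : 0 < ℤ.∣ M ∣

  cofactor : ∀ {i} (M : ℤ) → 0 < d N (suc i) → + d N (suc i) ≡ P ℤ.* M → Cofactor (d N (suc i)) M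
  cofactor {i} M d>0 d≡PM = record
    { x≡pm = d≡pm
    ; +m≡M = proj₂ (factor-pos M d≡PM)
    ; m∣N  = ∣-trans (subst (ℤ.∣ M ∣ ∣_) (sym d≡pm) (n∣m*n p)) (d-∣ {N} d>0)
    ; m>0  = n≢0⇒n>0 λ m≡0 → n>0⇒n≢0 d>0 (trans d≡pm (trans (cong (p *_) m≡0) (*-zeroʳ p)))
    }
    where
    d≡pm : d N (suc i) ≡ p * ℤ.∣ M ∣
    d≡pm = proj₁ (factor-pos M d≡PM)

  M₆ : ℤ
  M₆ = A ℤ.* R ℤ.+ P ℤ.* P ℤ.- A ℤ.* P ℤ.* Q

  d₆-equation : + d N 6 ≡ P ℤ.* M₆
  d₆-equation = trans (recurrence-at (s≤s (s≤s (s≤s (s≤s z≤n))))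
                                     (d∈S' (s≤s (s≤s z≤n)) (s≤s (s≤s (s≤s (s≤s (s≤s (s≤s (s≤s z≤n))))))))
                                     d₅≡r d₄≡p²)
    (trans (cong (λ x → A ℤ.* P ℤ.* R ℤ.+ (P ℤ.- A ℤ.* Q) ℤ.* x) +p*p≡P*P) (d₆-factor P Q R A))

  module C₆ = Cofactor (cofactor {5} M₆ (d>0 (s≤s (s≤s (s≤s (s≤s (s≤s z≤n)))))) d₆-equation)

  d₆≡pq : d N 6 ≡ p * q
  d₆≡pq = trans C₆.x≡pm (cong (p *_) (≤-antisym m≤q q≤m))
    where
    m : ℕ
    m = ℤ.∣ M₆ ∣
    r<d₆ : r < d N 6
    r<d₆ = subst (_< d N 6) d₅≡r (d-increasing (s≤s (s≤s (s≤s (s≤s z≤n)))))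
    m≤q : m ≤ q
    m≤q = *-cancelˡ-≤ p (subst (_≤ p * q) C₆.x≡pm
      (d-next≤ (s≤s (s≤s (s≤s (s≤s z≤n)))) pq∣N pq>0 (subst (_< p * q) (sym d₅≡r) r<pq)))
    m<q⇒m≤p : m < q → m ≤ p
    m<q⇒m≤p m<q = ≮⇒≥ λ p<m → <⇒≱ m<q
      (subst (_≤ m) d₃≡q (d-next≤ (s≤s z≤n) C₆.m∣N C₆.m>0 (subst (_< m) (sym d₂≡p) p<m)))
    q≤m : q ≤ m
    q≤m = ≮⇒≥ λ m<q → <⇒≱ (<-trans p²<r r<d₆) (subst (_≤ p * p) (sym C₆.x≡pm) (*-monoʳ-≤ p (m<q⇒m≤p m<q)))

  Q≡M₆ : Q ≡ M₆
  Q≡M₆ = ℤP.*-cancelˡ-≡ P Q M₆ (trans (sym +p*q≡P*Q) (trans (cong +_ (sym d₆≡pq)) d₆-equation))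

  A-relation : A ℤ.* (P ℤ.* Q ℤ.- R) ≡ P ℤ.* P ℤ.- Q
  A-relation = A*[pq-r]≡p²-q P Q R A Q≡M₆

  A-positive : ∃ λ α → A ≡ + suc α
  A-positive = positive-factor A (m<n⇒0<n∸m r<pq) (m<n⇒0<n∸m q<p²) (begin
    A ℤ.* + (p * q ∸ r)  ≡⟨ cong (A ℤ.*_) (trans (pos-∸ (<⇒≤ r<pq)) (cong (ℤ._- R) +p*q≡P*Q)) ⟩
    A ℤ.* (P ℤ.* Q ℤ.- R) ≡⟨ A-relation ⟩
    P ℤ.* P ℤ.- Q         ≡⟨ trans (cong (ℤ._- Q) (sym +p*p≡P*P)) (sym (pos-∸ (<⇒≤ q<p²))) ⟩
    + (p * p ∸ q)         ∎)
    where open ≡-Reasoning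

  α : ℕ
  α = proj₁ A-positive
  A≡1+α : A ≡ + suc α
  A≡1+α = proj₂ A-positive

  d₇-equation : + d N 7 ≡ A ℤ.* P ℤ.* (P ℤ.* Q) ℤ.+ (P ℤ.- A ℤ.* Q) ℤ.* R
  d₇-equation = trans (recurrence-at (s≤s (s≤s (s≤s (s≤s z≤n)))) (d∈S' (s≤s (s≤s z≤n)) ≤-refl) d₆≡pq d₅≡r)
    (cong (λ x → A ℤ.* P ℤ.* x ℤ.+ (P ℤ.- A ℤ.* Q) ℤ.* R) +p*q≡P*Q)

  d₇<pr : d N 7 < p * r
  d₇<pr = subst (d N 7 <_) (sym pr≡d₇+excess)
    (m<m+n (d N 7) (*-mono-< (*-mono-< {0} {suc α} (s≤s z≤n) (≤-trans (s≤s z≤n) (prime>1 q-prime))) (m<n⇒0<n∸m p²<r)))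
    where
    open ≡-Reasoning
    excess : A ℤ.* Q ℤ.* (R ℤ.- P ℤ.* P) ≡ + (suc α * q * (r ∸ p * p))
    excess = begin
      A ℤ.* Q ℤ.* (R ℤ.- P ℤ.* P)
        ≡⟨ cong₂ (λ x y → x ℤ.* Q ℤ.* y) A≡1+α (trans (cong (λ x → R ℤ.- x) (sym +p*p≡P*P)) (sym (pos-∸ (<⇒≤ p²<r)))) ⟩
      + suc α ℤ.* Q ℤ.* + (r ∸ p * p)      ≡⟨ cong (ℤ._* + (r ∸ p * p)) (ℤP.pos-* (suc α) q) ⟨
      + (suc α * q) ℤ.* + (r ∸ p * p)      ≡⟨ ℤP.pos-* (suc α * q) (r ∸ p * p) ⟨
      + (suc α * q * (r ∸ p * p))          ∎
    pr≡d₇+excess : p * r ≡ d N 7 + suc α * q * (r ∸ p * p)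
    pr≡d₇+excess = ℤP.+-injective (begin
      + (p * r)                                                          ≡⟨ ℤP.pos-* p r ⟩
      P ℤ.* R                                                            ≡⟨ pr≡d₇+Aq[r-p²] P Q R A ⟩
      A ℤ.* P ℤ.* (P ℤ.* Q) ℤ.+ (P ℤ.- A ℤ.* Q) ℤ.* R ℤ.+ A ℤ.* Q ℤ.* (R ℤ.- P ℤ.* P)
        ≡⟨ cong₂ ℤ._+_ (sym d₇-equation) excess ⟩
      + d N 7 ℤ.+ + (suc α * q * (r ∸ p * p))                            ≡⟨ ℤP.pos-+ (d N 7) _ ⟨
      + (d N 7 + suc α * q * (r ∸ p * p))                                ∎)

  d₈≤pr : d N 8 ≤ p * r
  d₈≤pr = d-next≤ (s≤s (s≤s (s≤s (s≤s (s≤s (s≤s z≤n)))))) pr∣N pr>0 d₇<pr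

  d₈²≢N : d N 8 * d N 8 ≢ N
  d₈²≢N d₈²≡N = <⇒≱ p<q (*-cancelʳ-≤ q p r (≤-trans (∣⇒≤ {{>-nonZero d₈>0}} qr∣d₈) d₈≤pr))
    where
    prime∣d₈ : ∀ {x} → Prime x → x ∣ N → x ∣ d N 8
    prime∣d₈ x-prime x∣N = prime∣m*m⇒∣m x-prime (subst (_ ∣_) (sym d₈²≡N) x∣N)
    qr∣d₈ : q * r ∣ d N 8
    qr∣d₈ = coprime⇒*∣ (primes-coprime q-prime r-prime q<r) (prime∣d₈ q-prime q∣N) (prime∣d₈ r-prime r∣N)

  d₈∈S' : InS' N (d N 8)
  d₈∈S' = d-∣ {N} d₈>0 ,
          <-trans (proj₁ (proj₂ (d∈S' {7} (s≤s (s≤s z≤n)) ≤-refl))) (d-increasing (s≤s (s≤s (s≤s (s≤s (s≤s (s≤s z≤n))))))) ,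
          ≤∧≢⇒< d₈²≤N d₈²≢N

  M₈ : ℤ
  M₈ = A ℤ.* + d N 7 ℤ.+ P ℤ.* Q ℤ.- A ℤ.* Q ℤ.* Q

  d₈-equation : + d N 8 ≡ P ℤ.* M₈
  d₈-equation = trans (recurrence-at (s≤s (s≤s (s≤s (s≤s z≤n)))) d₈∈S' refl d₆≡pq)
    (trans (cong (λ x → A ℤ.* P ℤ.* + d N 7 ℤ.+ (P ℤ.- A ℤ.* Q) ℤ.* x) +p*q≡P*Q) (d₈-factor P Q A (+ d N 7)))

  module C₈ = Cofactor (cofactor {7} M₈ d₈>0 d₈-equation)

  m₈ : ℕ
  m₈ = ℤ.∣ M₈ ∣

  q<m₈ : q < m₈
  q<m₈ = *-cancelˡ-< p q m₈ (subst₂ _<_ d₆≡pq C₈.x≡pm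
    (<-trans (d-increasing (s≤s (s≤s (s≤s (s≤s (s≤s z≤n)))))) (d-increasing (s≤s (s≤s (s≤s (s≤s (s≤s (s≤s z≤n)))))))))
  p²≤m₈ : p * p ≤ m₈
  p²≤m₈ = subst (_≤ m₈) d₄≡p² (d-next≤ (s≤s (s≤s z≤n)) C₈.m∣N C₈.m>0 (subst (_< m₈) (sym d₃≡q) q<m₈))
  m₈≤r : m₈ ≤ r
  m₈≤r = *-cancelˡ-≤ p (subst (_≤ p * r) C₈.x≡pm d₈≤pr)

  m₈≡p²⊎m₈≡r : m₈ ≡ p * p ⊎ m₈ ≡ r
  m₈≡p²⊎m₈≡r = [ (λ p²<m₈ → inj₂ (≤-antisym m₈≤r (r≤m₈ p²<m₈))) , (λ p²≡m₈ → inj₁ (sym p²≡m₈)) ]′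
    (m≤n⇒m<n∨m≡n p²≤m₈)
    where
    r≤m₈ : p * p < m₈ → r ≤ m₈
    r≤m₈ p²<m₈ = subst (_≤ m₈) d₅≡r (d-next≤ (s≤s (s≤s (s≤s z≤n))) C₈.m∣N C₈.m>0 (subst (_< m₈) (sym d₄≡p²) p²<m₈))

  p-Aq≢0 : P ℤ.- A ℤ.* Q ≢ 0ℤ
  p-Aq≢0 p-Aq≡0 = <⇒≱ p<q (subst (q ≤_) (sym p≡[1+α]q) (m≤n*m q (suc α)))
    where
    p≡[1+α]q : p ≡ suc α * q
    p≡[1+α]q = ℤP.+-injective (trans (ℤP.i-j≡0⇒i≡j P (A ℤ.* Q) p-Aq≡0)
                                     (trans (cong (ℤ._* Q) A≡1+α) (sym (ℤP.pos-* (suc α) q))))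

  r-p²≢0 : R ℤ.- P ℤ.* P ≢ 0ℤ
  r-p²≢0 r-p²≡0 = <-irrefl (sym (ℤP.+-injective (trans (ℤP.i-j≡0⇒i≡j R (P ℤ.* P) r-p²≡0) (sym +p*p≡P*P)))) p²<r

  m₈≡r⇒d₇≡p³ : m₈ ≡ r → + d N 7 ≡ P ℤ.* P ℤ.* P
  m₈≡r⇒d₇≡p³ m₈≡r = ℤP.*-cancelˡ-≡ A _ _ {{subst ℤ.NonZero (sym A≡1+α) _}}
    (r-cofactor⇒Ad₇≡Ap³ P Q R A (+ d N 7) (trans (cong +_ (sym m₈≡r)) C₈.+m≡M) d₅-equation)

  m₈≢r : m₈ ≢ r
  m₈≢r m₈≡r = [ p-Aq≢0 , r-p²≢0 ]′ (ℤP.i*j≡0⇒i≡0∨j≡0 (P ℤ.- A ℤ.* Q)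
    (d₇≡p³⇒[p-Aq][r-p²]≡0 P Q R A (trans (sym (m₈≡r⇒d₇≡p³ m₈≡r)) d₇-equation)))

  m₈≡p²⇒q∣p²[p+1] : m₈ ≡ p * p → q ∣ p * p * (p + 1)
  m₈≡p²⇒q∣p²[p+1] m₈≡p² = ∣-from-≡ _ (trans p²[p+1]≡
    (p²-cofactor⇒p²[p+1]≡q*X P Q R A (+ d N 7) (trans (sym +p*p≡P*P) (trans (cong +_ (sym m₈≡p²)) C₈.+m≡M)) Q≡M₆ d₇-equation))
    where
    p²[p+1]≡ : + (p * p * (p + 1)) ≡ P ℤ.* P ℤ.* (P ℤ.+ 1ℤ)
    p²[p+1]≡ = trans (ℤP.pos-* (p * p) (p + 1)) (cong₂ ℤ._*_ +p*p≡P*P (ℤP.pos-+ p 1))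

  m₈≡p²⇒q≡1+p : m₈ ≡ p * p → q ≡ suc p
  m₈≡p²⇒q≡1+p m₈≡p² =
    [ (λ q∣p² → ⊥-elim (<⇒≱ p<q (∣⇒≤ (prime∣m*m⇒∣m q-prime q∣p²))))
    , (λ q∣p+1 → ≤-antisym (∣⇒≤ (subst (q ∣_) (+-comm p 1) q∣p+1)) p<q)
    ]′ (euclidsLemma (p * p) (p + 1) q-prime (m₈≡p²⇒q∣p²[p+1] m₈≡p²))

  m₈≢p² : m₈ ≢ p * p
  m₈≢p² m₈≡p² = prefix-absurd N>0 recurrent₂,₃ prefix
    where
    open ≡-Reasoning
    q≡1+p : q ≡ suc p
    q≡1+p = m₈≡p²⇒q≡1+p m₈≡p²
    p≡2 : p ≡ 2
    p≡2 = consecutive-primes p-prime (subst Prime q≡1+p q-prime)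
    q≡3 : q ≡ 3
    q≡3 = trans q≡1+p (cong suc p≡2)
    r≡5 : r ≡ 5
    r≡5 = ≤-antisym (s≤s⁻¹ (subst (r <_) (cong₂ _*_ p≡2 q≡3) r<pq)) (subst (_< r) (cong₂ _*_ p≡2 p≡2) p²<r)
    A≡1 : A ≡ + 1
    A≡1 = begin
      A                      ≡⟨ ℤP.*-identityʳ A ⟨
      A ℤ.* (+ 6 ℤ.- + 5)    ≡⟨ cong₂ (λ x y → A ℤ.* (+ x ℤ.- + y)) (cong₂ _*_ p≡2 q≡3) r≡5 ⟨
      A ℤ.* (+ (p * q) ℤ.- R) ≡⟨ cong (λ x → A ℤ.* (x ℤ.- R)) +p*q≡P*Q ⟩
      A ℤ.* (P ℤ.* Q ℤ.- R)   ≡⟨ A-relation ⟩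
      P ℤ.* P ℤ.- Q           ≡⟨ cong (ℤ._- Q) +p*p≡P*P ⟨
      + (p * p) ℤ.- Q         ≡⟨ cong₂ (λ x y → + x ℤ.- + y) (cong₂ _*_ p≡2 p≡2) q≡3 ⟩
      + 1                     ∎
    coefficients≡ : ∀ {B x y} → B ≡ + 1 → x ≡ 2 → y ≡ 3 → B ℤ.* + x ≡ + 2 × + x ℤ.- B ℤ.* + y ≡ -1ℤ
    coefficients≡ refl refl refl = refl , refl
    AP≡2 : A ℤ.* P ≡ + 2
    AP≡2 = proj₁ (coefficients≡ A≡1 p≡2 q≡3)
    P-AQ≡-1 : P ℤ.- A ℤ.* Q ≡ -1ℤ
    P-AQ≡-1 = proj₂ (coefficients≡ A≡1 p≡2 q≡3)
    d₇≡7 : d N 7 ≡ 7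
    d₇≡7 = ℤP.+-injective (begin
      + d N 7                                        ≡⟨ d₇-equation ⟩
      A ℤ.* P ℤ.* (P ℤ.* Q) ℤ.+ (P ℤ.- A ℤ.* Q) ℤ.* R ≡⟨ cong₂ (λ x y → x ℤ.* (P ℤ.* Q) ℤ.+ y ℤ.* R) AP≡2 P-AQ≡-1 ⟩
      + 2 ℤ.* (P ℤ.* Q) ℤ.+ -1ℤ ℤ.* R            ≡⟨ cong (λ x → + 2 ℤ.* x ℤ.+ -1ℤ ℤ.* R) +p*q≡P*Q ⟨
      + 2 ℤ.* + (p * q) ℤ.+ -1ℤ ℤ.* R            ≡⟨ cong₂ (λ x y → + 2 ℤ.* + x ℤ.+ -1ℤ ℤ.* + y) (cong₂ _*_ p≡2 q≡3) r≡5 ⟩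
      + 7                                            ∎)
    prefix : Prefix N 8
    prefix 0 _ = d-1≡1 {N} N>0
    prefix 1 _ = trans d₂≡p p≡2
    prefix 2 _ = trans d₃≡q q≡3
    prefix 3 _ = trans d₄≡p² (cong₂ _*_ p≡2 p≡2)
    prefix 4 _ = trans d₅≡r r≡5
    prefix 5 _ = trans d₆≡pq (cong₂ _*_ p≡2 q≡3)
    prefix 6 _ = d₇≡7
    prefix 7 _ = trans C₈.x≡pm (cong₂ _*_ p≡2 (trans m₈≡p² (cong₂ _*_ p≡2 p≡2)))
    prefix (suc (suc (suc (suc (suc (suc (suc (suc _)))))))) (s≤s (s≤s (s≤s (s≤s (s≤s (s≤s (s≤s (s≤s ()))))))))
    recurrent₂,₃ : SmallRecurrent N 2 3 (+ 2) -1ℤ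
    recurrent₂,₃ = trans d₂≡p p≡2 , trans d₃≡q q≡3 , λ i 4≤i ∈S' →
      trans (recurrence-at 4≤i ∈S' refl refl) (cong₂ (λ x y → x ℤ.* + d N (i ∸ 1) ℤ.+ y ℤ.* + d N (i ∸ 2)) AP≡2 P-AQ≡-1)

  impossible : ⊥
  impossible = [ m₈≢p² , m₈≢r ]′ m₈≡p²⊎m₈≡r

proposition3p1 : (p q r N : ℕ) (a b : ℤ) →
    Prime p → Prime q → Prime r → p < q → q < r → 1 < N →
    d N 2 ≡ p → d N 3 ≡ q → d N 4 ≡ p * p → d N 5 ≡ r →
    InS' N p → InS' N q → InS' N (p * p) → InS' N r →
    SmallRecurrent N p q a b →
    length (S N) ≤ 7 × length (S' N) ≤ 6
proposition3p1 p q r N a b p-prime q-prime r-prime p<q q<r 1<N d₂≡p d₃≡q d₄≡p² d₅≡r _ _ _ _ recurrent =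
  length-S-≤ 7 d₈-beyond-root , length-S'-≤ 6 N>0 d₈-beyond-root
  where
  N>0 : 0 < N
  N>0 = <-trans z<s 1<N
  d₈-beyond-root : 0 < d N 8 → N < d N 8 * d N 8
  d₈-beyond-root d₈>0 = ≰⇒> λ d₈²≤N → EighthDivisorAtMostRoot.impossible {a = a} {b = b}
    p-prime q-prime r-prime p<q q<r N>0 d₂≡p d₃≡q d₄≡p² d₅≡r recurrent d₈>0 d₈²≤N
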